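{- Let $w$ be a permutation, let $T\in\mathrm{KD}(w)$ be nonempty, and let $x$ be the lowest then rightmost cell of $T$ (the rightmost cell in the lowest nonempty row of $T$). If $x$ lies in column $c$, then some row of the Rothe diagram $\mathbb{D}(w)$ has its rightmost cell in column $c$.
   Context: Diagrams are finite sets of cells indexed by (row, column), rows numbered from the bottom starting at 1. The Rothe diagram is $\mathbb{D}(w)=\{(i,w_j)\mid i<j,\ w_i>w_j\}$ (cell in row $i$, column $w_j$). A Kohnert move selects the rightmost cell of a given row and moves it down within its column to the first unoccupied position below, if any, jumping over cells in the way. $\mathrm{KD}(w)$ is the set of diagrams obtainable from $\mathbb{D}(w)$ by finite sequences of Kohnert moves. -}

module Defs where

open import Data.Nat using (ℕ; suc; _<_; _≤_)
open import Data.Fin using (Fin; toℕ)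
open import Data.Fin.Permutation using (Permutation′; _⟨$⟩ʳ_)
open import Data.Product using (Σ; ∃; _×_; _,_)
open import Data.Sum using (_⊎_)
open import Relation.Nullary using (¬_)
open import Relation.Binary.PropositionalEquality using (_≡_)
open import Relation.Binary.Construct.Closure.ReflexiveTransitive using (Star)
open import Function.Bundles using (_⇔_)

-- A diagram: a set of cells, given as a predicate on (row, column).
-- Rows and columns are numbered from 1 (row 1 is the bottom row).
Diagram : Set₁
Diagram = ℕ → ℕ → Set

-- Rothe diagram of a permutation w of {1..n} (Fin n is shifted by one):
-- cell (i, w_j) for i < j with w_i > w_j.
Rothe : ∀ {n} → Permutation′ n → Diagram
Rothe {n} w row col =
  Σ (Fin n) λ i → Σ (Fin n) λ j →
    (toℕ i < toℕ j) × (toℕ (w ⟨$⟩ʳ j) < toℕ (w ⟨$⟩ʳ i)) ×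
    (row ≡ suc (toℕ i)) × (col ≡ suc (toℕ (w ⟨$⟩ʳ j)))

KohnertMove : Diagram → Diagram → Set
KohnertMove D D' =
  Σ ℕ λ r → Σ ℕ λ c → Σ ℕ λ r' →
    D r c ×
    (∀ c' → D r c' → c' ≤ c) ×
    1 ≤ r' × r' < r ×
    ¬ D r' c ×
    (∀ r'' → r' < r'' → r'' < r → D r'' c) ×
    (∀ a b → D' a b ⇔ ((D a b × ¬ (a ≡ r × b ≡ c)) ⊎ (a ≡ r' × b ≡ c)))

InKD : ∀ {n} → Permutation′ n → Diagram → Set₁
InKD w T = Star KohnertMove (Rothe w) T

{-# OPTIONS --safe #-}
-- Say that column cs dominates column c of a diagram if, for every h, column cs has at least as
-- many cells in rows ≤ h as column c. In the Rothe diagram every column is contained in, hence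
-- dominated by, a column that is the rightmost column of some row: for a cell (i, w_j) with i the
-- inversion partner of j of least value w_i, either w_j is rightmost in row i or some value w_k
-- lies strictly between w_j and w_i, and then k > j and column w_k contains column w_j.
-- A Kohnert move from row r to row r′ in column c raises the prefix counts of column c only for
-- r′ ≤ h < r; there column c is full up to row r while any column to its right misses row r, so
-- domination by columns to the right survives every move. Finally, were the lowest-rightmost cell
-- of T in a column c dominated by a column cs > c, column cs would have a cell in a row ≤ r,
-- hence in the lowest row r, to the right of c.
module Submission where

open import Algebra.Properties.CommutativeSemigroup using (interchange)
open import Data.Empty using (⊥-elim)
open import Data.Fin using (Fin; toℕ)
open import Data.Fin.Permutation using (Permutation′; _⟨$⟩ʳ_; _⟨$⟩ˡ_; inverseˡ)
open import Data.Fin.Properties using (toℕ-injective; any?; toℕ<n)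
open import Data.Nat using (ℕ; zero; suc; _+_; _∸_; _≤_; _<_; z≤n; s≤s; _≟_; _≤?_; _<?_)
open import Data.Nat.Induction using (<-wellFounded)
open import Data.Nat.Properties
open import Data.Product using (Σ; ∃; _×_; _,_)
open import Data.Sum using (_⊎_; inj₁; inj₂; [_,_]′)
open import Defs
open import Function.Bundles using (Equivalence; _⇔_)
open import Induction.WellFounded using (Acc; acc)
open import Relation.Binary using (tri<; tri≈; tri>)
open import Relation.Binary.Definitions using () renaming (Decidable to Decidable₂)
open import Relation.Binary.Construct.Closure.ReflexiveTransitive using (Star; ε; _◅_)
open import Relation.Binary.PropositionalEquality
open import Relation.Nullary using (¬_; Dec; yes; no)
open import Relation.Nullary.Decidable using (_×-dec_; _⊎-dec_; ¬?; map′)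
open import Relation.Unary using (Decidable; _⊆_)

indicator : {A : Set} → Dec A → ℕ
indicator (yes _) = 1
indicator (no _)  = 0

indicator-mono : {A B : Set} → (A → B) → (A? : Dec A) (B? : Dec B) → indicator A? ≤ indicator B?
indicator-mono f (yes a) (yes _) = ≤-refl
indicator-mono f (yes a) (no ¬b) = ⊥-elim (¬b (f a))
indicator-mono f (no _)  _       = z≤n

indicator≤1 : {A : Set} (A? : Dec A) → indicator A? ≤ 1
indicator≤1 (yes _) = ≤-refl
indicator≤1 (no _)  = z≤n

indicator-no : {A : Set} → ¬ A → (A? : Dec A) → indicator A? ≡ 0
indicator-no ¬a (yes a) = ⊥-elim (¬a a)
indicator-no ¬a (no _)  = refl

indicator-yes : {A : Set} → A → (A? : Dec A) → indicator A? ≡ 1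
indicator-yes a (yes _) = refl
indicator-yes a (no ¬a) = ⊥-elim (¬a a)

indicator-cong : {A B : Set} → (A → B) → (B → A) → (A? : Dec A) (B? : Dec B) → indicator A? ≡ indicator B?
indicator-cong f g A? B? = ≤-antisym (indicator-mono f A? B?) (indicator-mono g B? A?)

count : {P : ℕ → Set} → Decidable P → ℕ → ℕ
count P? zero    = indicator (P? zero)
count P? (suc h) = indicator (P? (suc h)) + count P? h

count-mono : {P Q : ℕ → Set} (P? : Decidable P) (Q? : Decidable Q) →
  P ⊆ Q → ∀ h → count P? h ≤ count Q? h
count-mono P? Q? P⊆Q zero    = indicator-mono P⊆Q (P? zero) (Q? zero)
count-mono P? Q? P⊆Q (suc h) =
  +-mono-≤ (indicator-mono P⊆Q (P? (suc h)) (Q? (suc h))) (count-mono P? Q? P⊆Q h)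

count-cong : {P Q : ℕ → Set} (P? : Decidable P) (Q? : Decidable Q) →
  P ⊆ Q → Q ⊆ P → ∀ h → count P? h ≡ count Q? h
count-cong P? Q? P⊆Q Q⊆P h = ≤-antisym (count-mono P? Q? P⊆Q h) (count-mono Q? P? Q⊆P h)

module _ {P : ℕ → Set} (P? : Decidable P) where

  count-positive : ∀ {a} h → a ≤ h → P a → 0 < count P? h
  count-positive zero z≤n pa with P? zero
  ... | yes _  = s≤s z≤n
  ... | no ¬pa = ⊥-elim (¬pa pa)
  count-positive {a} (suc h) a≤h pa with P? (suc h) | a ≟ suc h
  ... | yes _  | _        = s≤s z≤n
  ... | no ¬pa | yes refl = ⊥-elim (¬pa pa)
  ... | no _   | no a≢h   = count-positive h (≤-pred (≤∧≢⇒< a≤h a≢h)) pa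

  count-witness : ∀ h → 0 < count P? h → ∃ λ a → a ≤ h × P a
  count-witness zero pos with P? zero
  ... | yes pa = zero , z≤n , pa
  count-witness (suc h) pos with P? (suc h)
  ... | yes pa = suc h , ≤-refl , pa
  ... | no _ with count-witness h pos
  ...   | a , a≤h , pa = a , m≤n⇒m≤1+n a≤h , pa

  count-interval : ∀ h k → (∀ {a} → h < a → a ≤ k + h → P a) → count P? (k + h) ≡ k + count P? h
  count-interval h zero    full = refl
  count-interval h (suc k) full with P? (suc (k + h))
  ... | yes _  = cong suc (count-interval h k λ h<a a≤ → full h<a (m≤n⇒m≤1+n a≤))
  ... | no ¬pa = ⊥-elim (¬pa (full (s≤s (m≤n+m h k)) ≤-refl))

  count-≤-+ : ∀ h k → count P? (k + h) ≤ k + count P? h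
  count-≤-+ h zero    = ≤-refl
  count-≤-+ h (suc k) = +-mono-≤ (indicator≤1 (P? (suc (k + h)))) (count-≤-+ h k)

count-+ : {P Q R S : ℕ → Set}
  (P? : Decidable P) (Q? : Decidable Q) (R? : Decidable R) (S? : Decidable S) →
  (∀ a → indicator (P? a) + indicator (Q? a) ≡ indicator (R? a) + indicator (S? a)) →
  ∀ h → count P? h + count Q? h ≡ count R? h + count S? h
count-+ P? Q? R? S? pointwise zero    = pointwise zero
count-+ P? Q? R? S? pointwise (suc h) = begin
  (p + count P? h) + (q + count Q? h) ≡⟨ interchange +-commutativeSemigroup p _ q _ ⟩
  (p + q) + (count P? h + count Q? h) ≡⟨ cong₂ _+_ (pointwise (suc h)) (count-+ P? Q? R? S? pointwise h) ⟩
  (r + s) + (count R? h + count S? h) ≡⟨ interchange +-commutativeSemigroup r _ s _ ⟨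
  (r + count R? h) + (s + count S? h) ∎
  where
  open ≡-Reasoning
  p = indicator (P? (suc h))
  q = indicator (Q? (suc h))
  r = indicator (R? (suc h))
  s = indicator (S? (suc h))

count-≟-below : ∀ {r} h → h < r → count (_≟ r) h ≡ 0
count-≟-below zero    h<r = indicator-no (λ e → <-irrefl e h<r) (zero ≟ _)
count-≟-below (suc h) h<r =
  cong₂ _+_ (indicator-no (λ e → <-irrefl e h<r) (suc h ≟ _)) (count-≟-below h (<-trans (n<1+n h) h<r))

count-≟-above : ∀ {r} h → r ≤ h → count (_≟ r) h ≡ 1
count-≟-above zero    z≤n = refl
count-≟-above {r} (suc h) r≤h with suc h ≟ r
... | yes refl = cong suc (count-≟-below h ≤-refl)
... | no h≢r   = count-≟-above h (≤-pred (≤∧≢⇒< r≤h (λ e → h≢r (sym e))))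

-- On (h, r] the count of P grows by r − h but that of Q by at most r − h − 1.
count-strict-gap : {P Q : ℕ → Set} (P? : Decidable P) (Q? : Decidable Q) →
  (∀ h → count P? h ≤ count Q? h) →
  ∀ {h r} → h < r → (∀ {a} → h < a → a ≤ r → P a) → ¬ Q r → suc (count P? h) ≤ count Q? h
count-strict-gap P? Q? dom {h} h<r full ¬qr with m≤n⇒∃[o]m+o≡n h<r
... | k , refl = +-cancelˡ-≤ k _ _ (begin
  k + suc (count P? h)     ≡⟨ +-suc k _ ⟩
  suc k + count P? h       ≡⟨ count-interval P? h (suc k) (λ h<a a≤ → full h<a (≤-trans a≤ (≤-reflexive (cong suc (+-comm k h))))) ⟨
  count P? (suc k + h)     ≤⟨ dom (suc k + h) ⟩
  count Q? (suc (k + h))   ≡⟨ cong (λ x → count Q? (suc x)) (+-comm k h) ⟩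
  count Q? (suc (h + k))   ≡⟨ cong (_+ count Q? (h + k)) (indicator-no ¬qr (Q? (suc (h + k)))) ⟩
  count Q? (h + k)         ≡⟨ cong (count Q?) (+-comm h k) ⟩
  count Q? (k + h)         ≤⟨ count-≤-+ Q? h k ⟩
  k + count Q? h           ∎)
  where open ≤-Reasoning

module _ {P : ℕ → Set} (P? : Decidable P) where

  private
    search : ∀ m → (∀ {k} → k < m → ¬ P k) ⊎ ∃ (λ k → P k × (∀ {k′} → k′ < k → ¬ P k′))
    search zero = inj₁ λ ()
    search (suc m) with search m
    ... | inj₂ found = inj₂ found
    ... | inj₁ none with P? m
    ...   | yes pm = inj₂ (m , pm , none)
    ...   | no ¬pm = inj₁ λ k<1+m → [ none , (λ k≡m pk → ¬pm (subst P k≡m pk)) ]′ (m<1+n⇒m<n∨m≡n k<1+m)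

  least : ∀ {m} → P m → ∃ λ k → P k × (∀ {k′} → k′ < k → ¬ P k′)
  least {m} pm with search m
  ... | inj₁ none  = m , pm , none
  ... | inj₂ found = found

column : Diagram → ℕ → ℕ → Set
column D b a = D a b

module RotheDiagram {n} (w : Permutation′ n) where

  value : Fin n → ℕ
  value i = toℕ (w ⟨$⟩ʳ i)

  value-injective : ∀ {i j} → value i ≡ value j → i ≡ j
  value-injective {i} {j} wi≡wj = begin
    i                   ≡⟨ inverseˡ w ⟨
    w ⟨$⟩ˡ (w ⟨$⟩ʳ i)  ≡⟨ cong (w ⟨$⟩ˡ_) (toℕ-injective wi≡wj) ⟩
    w ⟨$⟩ˡ (w ⟨$⟩ʳ j)  ≡⟨ inverseˡ w ⟩
    j                   ∎
    where open ≡-Reasoning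

  Rothe? : Decidable₂ (Rothe w)
  Rothe? a b = any? λ i → any? λ j →
    (toℕ i <? toℕ j) ×-dec (value j <? value i) ×-dec (a ≟ suc (toℕ i)) ×-dec (b ≟ suc (value j))

  RightmostColumn : ℕ → Set
  RightmostColumn c = Σ ℕ λ i → Rothe w i c × (∀ c′ → Rothe w i c′ → c′ ≤ c)

  Inversion : Fin n → Fin n → Set
  Inversion i j = toℕ i < toℕ j × value j < value i

  InversionValue : Fin n → ℕ → Set
  InversionValue j v = ∃ λ i → Inversion i j × value i ≡ v

  InversionValue? : ∀ j → Decidable (InversionValue j)
  InversionValue? j v = any? λ i → ((toℕ i <? toℕ j) ×-dec (value j <? value i)) ×-dec (value i ≟ v)

  least-inversion : ∀ {i₀ j} → Inversion i₀ j →
    ∃ λ i → Inversion i j × (∀ {i′} → Inversion i′ j → value i ≤ value i′)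
  least-inversion {i₀} {j} inv₀ with least (InversionValue? j) (i₀ , inv₀ , refl)
  ... | _ , (i , inv , refl) , minimal = i , inv , λ inv′ → ≮⇒≥ λ lt → minimal lt (_ , inv′ , refl)

  row-rightmost-or-between : ∀ i j →
    (∀ c′ → Rothe w (suc (toℕ i)) c′ → c′ ≤ suc (value j)) ⊎
    ∃ λ k → value j < value k × value k < value i
  row-rightmost-or-between i j
    with any? (λ k → (toℕ i <? toℕ k) ×-dec (value j <? value k) ×-dec (value k <? value i))
  ... | yes (k , _ , between) = inj₂ (k , between)
  ... | no ¬between = inj₁ bound
    where
    bound : ∀ c′ → Rothe w (suc (toℕ i)) c′ → c′ ≤ suc (value j)
    bound _ (i′ , k , i′<k , wk<wi′ , row≡ , refl) with toℕ-injective (suc-injective row≡)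
    ... | refl with value k ≤? value j
    ...   | yes wk≤wj = s≤s wk≤wj
    ...   | no wk≰wj  = ⊥-elim (¬between (k , i′<k , ≰⇒> wk≰wj , wk<wi′))

  -- A value strictly between w_j and its least inversion partner w_i sits to the right of j
  -- (to its left it would be a smaller partner), and then every row meeting column w_j
  -- also meets column w_k.
  column-shift : ∀ {i j k} → (∀ {i′} → Inversion i′ j → value i ≤ value i′) →
    value j < value k → value k < value i →
    column (Rothe w) (suc (value j)) ⊆ column (Rothe w) (suc (value k))
  column-shift {i} {j} {k} minimal wj<wk wk<wi (i′ , j′ , i′<j′ , wj′<wi′ , row≡ , col≡)
    with value-injective (suc-injective col≡) | <-cmp (toℕ k) (toℕ j)
  ... | refl | tri< k<j _ _ = ⊥-elim (<⇒≱ wk<wi (minimal (k<j , wj<wk)))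
  ... | refl | tri≈ _ k≡j _ = ⊥-elim (<-irrefl (cong value (toℕ-injective (sym k≡j))) wj<wk)
  ... | refl | tri> _ _ j<k =
    i′ , k , <-trans i′<j′ j<k , <-≤-trans wk<wi (minimal (i′<j′ , wj′<wi′)) , row≡ , refl

  rightmost-or-shift : ∀ {a b} → Rothe w a b → RightmostColumn b ⊎
    ∃ λ b′ → b < b′ × b′ ≤ n × column (Rothe w) b ⊆ column (Rothe w) b′
  rightmost-or-shift (i₀ , j , i₀<j , wj<wi₀ , _ , refl) with least-inversion (i₀<j , wj<wi₀)
  ... | i , (i<j , wj<wi) , minimal with row-rightmost-or-between i j
  ...   | inj₁ bound = inj₁ (suc (toℕ i) , (i , j , i<j , wj<wi , refl , refl) , bound)
  ...   | inj₂ (k , wj<wk , wk<wi) =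
    inj₂ (suc (value k) , s≤s wj<wk , toℕ<n (w ⟨$⟩ʳ k) , column-shift minimal wj<wk wk<wi)

  rightmost-or-covered : ∀ {a b} → Rothe w a b → RightmostColumn b ⊎
    ∃ λ cs → RightmostColumn cs × b < cs × column (Rothe w) b ⊆ column (Rothe w) cs
  rightmost-or-covered {b = b} = climb b (<-wellFounded (n ∸ b))
    where
    climb : ∀ b → Acc _<_ (n ∸ b) → ∀ {a} → Rothe w a b → RightmostColumn b ⊎
      ∃ λ cs → RightmostColumn cs × b < cs × column (Rothe w) b ⊆ column (Rothe w) cs
    climb b (acc smaller) cell with rightmost-or-shift cell
    ... | inj₁ rightmost = inj₁ rightmost
    ... | inj₂ (b′ , b<b′ , b′≤n , b⊆b′) with climb b′ (smaller (∸-monoʳ-< b<b′ b′≤n)) (b⊆b′ cell)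
    ...   | inj₁ rightmost = inj₂ (b′ , rightmost , b<b′ , b⊆b′)
    ...   | inj₂ (cs , rightmost , b′<cs , b′⊆cs) =
      inj₂ (cs , rightmost , <-trans b<b′ b′<cs , λ cell′ → b′⊆cs (b⊆b′ cell′))

columnCount : {D : Diagram} → Decidable₂ D → ℕ → ℕ → ℕ
columnCount D? b = count (λ a → D? a b)

Dominates : {D : Diagram} → Decidable₂ D → ℕ → ℕ → Set
Dominates D? b cs = ∀ h → columnCount D? b h ≤ columnCount D? cs h

lowest-rightmost-undominated : {D : Diagram} (D? : Decidable₂ D) {r c cs : ℕ} → D r c →
  (∀ r′ c′ → D r′ c′ → r ≤ r′) → (∀ c′ → D r c′ → c′ ≤ c) → c < cs → ¬ Dominates D? c cs
lowest-rightmost-undominated D? {r} {c} {cs} Drc lowest rightmost c<cs dom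
  with count-witness (λ a → D? a cs) r (≤-trans (count-positive (λ a → D? a c) r ≤-refl Drc) (dom r))
... | a , a≤r , Dacs with ≤-antisym a≤r (lowest a cs Dacs)
...   | refl = <⇒≱ c<cs (rightmost cs Dacs)

module KohnertStep {D D′ : Diagram} (D? : Decidable₂ D) {r c r′ : ℕ}
  (Drc : D r c) (rightmost : ∀ c′ → D r c′ → c′ ≤ c) (r′<r : r′ < r) (¬Dr′c : ¬ D r′ c)
  (filled : ∀ a → r′ < a → a < r → D a c)
  (D′⇔ : ∀ a b → D′ a b ⇔ ((D a b × ¬ (a ≡ r × b ≡ c)) ⊎ (a ≡ r′ × b ≡ c))) where

  private
    to : ∀ {a b} → D′ a b → (D a b × ¬ (a ≡ r × b ≡ c)) ⊎ (a ≡ r′ × b ≡ c)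
    to {a} {b} = Equivalence.to (D′⇔ a b)

    from : ∀ {a b} → (D a b × ¬ (a ≡ r × b ≡ c)) ⊎ (a ≡ r′ × b ≡ c) → D′ a b
    from {a} {b} = Equivalence.from (D′⇔ a b)

  -- Opaque so that the case splits on _≟_ below do not unfold into it.
  opaque
    D′? : Decidable₂ D′
    D′? a b = map′ from to
      ((D? a b ×-dec ¬? ((a ≟ r) ×-dec (b ≟ c))) ⊎-dec ((a ≟ r′) ×-dec (b ≟ c)))

  kept : ∀ {a b} → D a b → ¬ (a ≡ r × b ≡ c) → D′ a b
  kept Dab ≢rc = from (inj₁ (Dab , ≢rc))

  kept′ : ∀ {a b} → D′ a b → ¬ (a ≡ r′ × b ≡ c) → D a b
  kept′ D′ab ≢r′c with to D′ab
  ... | inj₁ (Dab , _) = Dab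
  ... | inj₂ r′c       = ⊥-elim (≢r′c r′c)

  source : ∀ {a b} → D′ a b → ∃ λ a₀ → D a₀ b
  source {a} D′ab with to D′ab
  ... | inj₁ (Dab , _) = a , Dab
  ... | inj₂ (_ , refl) = r , Drc

  vacated : ¬ D′ r c
  vacated D′rc with to D′rc
  ... | inj₁ (_ , ≢rc) = ≢rc (refl , refl)
  ... | inj₂ (r≡r′ , _) = <-irrefl (sym r≡r′) r′<r

  landed : D′ r′ c
  landed = from (inj₂ (refl , refl))

  other-column : ∀ {b} → ¬ b ≡ c → ∀ h → columnCount D′? b h ≡ columnCount D? b h
  other-column b≢c = count-cong _ _
    (λ D′ab → kept′ D′ab λ (_ , b≡c) → b≢c b≡c) (λ Dab → kept Dab λ (_ , b≡c) → b≢c b≡c)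

  moved-pointwise : ∀ a → indicator (D′? a c) + indicator (a ≟ r) ≡ indicator (D? a c) + indicator (a ≟ r′)
  moved-pointwise a with a ≟ r | a ≟ r′
  ... | yes refl | yes a≡r′ = ⊥-elim (<-irrefl (sym a≡r′) r′<r)
  ... | yes refl | no _     =
    trans (cong (_+ 1) (indicator-no vacated _)) (sym (cong (_+ 0) (indicator-yes Drc _)))
  ... | no _     | yes refl =
    trans (cong (_+ 0) (indicator-yes landed _)) (sym (cong (_+ 1) (indicator-no ¬Dr′c _)))
  ... | no a≢r   | no a≢r′  = cong (_+ 0) (indicator-cong
    (λ D′ac → kept′ D′ac λ (a≡r′ , _) → a≢r′ a≡r′) (λ Dac → kept Dac λ (a≡r , _) → a≢r a≡r) _ _)

  -- Column c loses row r and gains row r′; stated additively to avoid truncated subtraction.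
  moved-balance : ∀ h → columnCount D′? c h + count (_≟ r) h ≡ columnCount D? c h + count (_≟ r′) h
  moved-balance = count-+ _ _ _ _ moved-pointwise

  moved-balance-at : ∀ h {e e′} → count (_≟ r) h ≡ e → count (_≟ r′) h ≡ e′ →
    columnCount D′? c h + e ≡ columnCount D? c h + e′
  moved-balance-at h eq eq′ =
    subst₂ (λ e e′ → columnCount D′? c h + e ≡ columnCount D? c h + e′) eq eq′ (moved-balance h)

  moved-column : ∀ h → columnCount D′? c h ≡ columnCount D? c h ⊎
    (r′ ≤ h × h < r × columnCount D′? c h ≡ suc (columnCount D? c h))
  moved-column h with r ≤? h | r′ ≤? h
  ... | yes r≤h | _ = inj₁ (+-cancelʳ-≡ 1 _ _
    (moved-balance-at h (count-≟-above h r≤h) (count-≟-above h (≤-trans (<⇒≤ r′<r) r≤h))))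
  ... | no r≰h | no r′≰h = inj₁ (+-cancelʳ-≡ 0 _ _
    (moved-balance-at h (count-≟-below h (≰⇒> r≰h)) (count-≟-below h (≰⇒> r′≰h))))
  ... | no r≰h | yes r′≤h = inj₂ (r′≤h , ≰⇒> r≰h , (begin
    columnCount D′? c h       ≡⟨ +-identityʳ _ ⟨
    columnCount D′? c h + 0   ≡⟨ moved-balance-at h (count-≟-below h (≰⇒> r≰h)) (count-≟-above h r′≤h) ⟩
    columnCount D? c h + 1    ≡⟨ +-comm _ 1 ⟩
    suc (columnCount D? c h)  ∎))
    where open ≡-Reasoning

  column-grows : ∀ b h → columnCount D? b h ≤ columnCount D′? b h
  column-grows b h with b ≟ c
  ... | no b≢c = ≤-reflexive (sym (other-column b≢c h))
  ... | yes refl with moved-column h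
  ...   | inj₁ eq            = ≤-reflexive (sym eq)
  ...   | inj₂ (_ , _ , eq)  = ≤-trans (n≤1+n _) (≤-reflexive (sym eq))

  moved-dominated : ∀ {cs} → c < cs → Dominates D? c cs → ∀ h → columnCount D′? c h ≤ columnCount D? cs h
  moved-dominated {cs} c<cs dom h with moved-column h
  ... | inj₁ eq = ≤-trans (≤-reflexive eq) (dom h)
  ... | inj₂ (r′≤h , h<r , eq) = ≤-trans (≤-reflexive eq)
    (count-strict-gap _ _ dom h<r full (λ Drcs → <⇒≱ c<cs (rightmost cs Drcs)))
    where
    full : ∀ {a} → h < a → a ≤ r → D a c
    full {a} h<a a≤r with m≤n⇒m<n∨m≡n a≤r
    ... | inj₁ a<r  = filled a (≤-<-trans r′≤h h<a) a<r
    ... | inj₂ refl = Drc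

  dominates-step : ∀ {b cs} → b ≤ cs → Dominates D? b cs → Dominates D′? b cs
  dominates-step {b} {cs} b≤cs dom h with m≤n⇒m<n∨m≡n b≤cs | b ≟ c
  ... | inj₂ refl | _        = ≤-refl
  ... | inj₁ c<cs | yes refl =
    ≤-trans (moved-dominated c<cs dom h) (≤-reflexive (sym (other-column (λ cs≡c → <-irrefl (sym cs≡c) c<cs) h)))
  ... | inj₁ _    | no b≢c   =
    ≤-trans (≤-reflexive (other-column b≢c h)) (≤-trans (dom h) (column-grows cs h))

module _ {n} (w : Permutation′ n) where
  open RotheDiagram w

  Covered : {D : Diagram} → Decidable₂ D → ℕ → Set
  Covered D? b = ∃ λ cs → RightmostColumn cs × b ≤ cs × Dominates D? b cs

  CoveredDiagram : Diagram → Set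
  CoveredDiagram D = Σ (Decidable₂ D) λ D? → ∀ {a b} → D a b → Covered D? b

  rothe-covered : CoveredDiagram (Rothe w)
  rothe-covered = Rothe? , λ cell → covered (rightmost-or-covered cell)
    where
    covered : ∀ {b} → RightmostColumn b ⊎
      (∃ λ cs → RightmostColumn cs × b < cs × column (Rothe w) b ⊆ column (Rothe w) cs) →
      Covered Rothe? b
    covered (inj₁ rightmost) = _ , rightmost , ≤-refl , λ _ → ≤-refl
    covered (inj₂ (cs , rightmost , b<cs , b⊆cs)) = cs , rightmost , <⇒≤ b<cs , count-mono _ _ b⊆cs

  kohnert-covered : ∀ {D D′} → KohnertMove D D′ → CoveredDiagram D → CoveredDiagram D′
  kohnert-covered {D′ = D′} (_ , _ , _ , Drc , rightmost , _ , r′<r , ¬Dr′c , filled , D′⇔) (D? , covered) =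
    D′? , covered′
    where
    open KohnertStep D? Drc rightmost r′<r ¬Dr′c filled D′⇔
    covered′ : ∀ {a b} → D′ a b → Covered D′? b
    covered′ D′ab with source D′ab
    ... | _ , Da₀b with covered Da₀b
    ...   | cs , rightmost-cs , b≤cs , dom = cs , rightmost-cs , b≤cs , dominates-step b≤cs dom

  kohnert-closure-covered : ∀ {D T} → Star KohnertMove D T → CoveredDiagram D → CoveredDiagram T
  kohnert-closure-covered ε              covered = covered
  kohnert-closure-covered (move ◅ moves) covered = kohnert-closure-covered moves (kohnert-covered move covered)

lemma15 : ∀ {n} (w : Permutation′ n) (T : Diagram) → InKD w T →
    (r c : ℕ) → T r c →
    (∀ r' c' → T r' c' → r ≤ r') →
    (∀ c' → T r c' → c' ≤ c) →
    Σ ℕ λ i → Rothe w i c × (∀ c' → Rothe w i c' → c' ≤ c)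
lemma15 w T kd r c Trc lowest rightmost with kohnert-closure-covered w kd (rothe-covered w)
... | T? , covered with covered Trc
...   | cs , rightmost-cs , c≤cs , dom with m≤n⇒m<n∨m≡n c≤cs
...     | inj₁ c<cs = ⊥-elim (lowest-rightmost-undominated T? Trc lowest rightmost c<cs dom)
...     | inj₂ refl = rightmost-cs
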